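{- Let $p_1,p_2,\dots,p_k$ be pairwise relatively prime positive integers. Then $$\tilde\Phi_{p_1,\dots,p_k}(x)=\prod_{\substack{m_i\mid p_i,\ m_i>1\\ (i=1,\dots,k)}}\Phi_{m_1m_2\cdots m_k}(x),$$ the product running over all tuples $(m_1,\dots,m_k)$ with $m_i$ a divisor of $p_i$ greater than $1$.
   Context: $\Phi_m(x)$ is the $m$th cyclotomic polynomial. For pairwise relatively prime positive integers $p_1,\dots,p_k$, the pseudocyclotomic polynomial is $\tilde\Phi_{p_1,\dots,p_k}(x)=\prod_{I\subseteq\{1,\dots,k\}}\bigl(x^{\prod_{i\in I}p_i}-1\bigr)^{(-1)^{k-|I|}}$ (empty product of the $p_i$ equals $1$). -}

module Defs where

open import Data.Nat as ℕ using (ℕ; zero; suc; _<?_)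
open import Data.Nat.Divisibility using (_∣?_)
open import Data.Integer as ℤ using (ℤ; +_; -_)
open import Data.Bool using (Bool; true; false; if_then_else_)
open import Data.List as List using (List; []; _∷_; _++_; map; foldr; filter; upTo; cartesianProductWith)
open import Data.Vec as Vec using (Vec; []; _∷_)
open import Relation.Binary.PropositionalEquality using (_≡_)

-- Formal power series over ℤ, as coefficient sequences.
-- ℤ[x] embeds in ℤ[[x]], so polynomial identities are checked here.

Series : Set
Series = ℕ → ℤ

infix 4 _≈ₛ_
_≈ₛ_ : Series → Series → Set
f ≈ₛ g = ∀ n → f n ≡ g n

oneₛ : Series
oneₛ zero    = + 1
oneₛ (suc _) = + 0

infixl 7 _*ₛ_
_*ₛ_ : Series → Series → Series
(f *ₛ g) n = foldr ℤ._+_ (+ 0) (map (λ i → f i ℤ.* g (n ℕ.∸ i)) (upTo (suc n)))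

prodₛ : List Series → Series
prodₛ = foldr _*ₛ_ oneₛ

xpow-1 : ℕ → Series
xpow-1 d n = (if n ℕ.≡ᵇ d then + 1 else + 0) ℤ.- (if n ℕ.≡ᵇ 0 then + 1 else + 0)

divisors : ℕ → List ℕ
divisors n = filter (_∣? n) (upTo (suc n))

divisors>1 : ℕ → List ℕ
divisors>1 n = filter (1 <?_) (divisors n)

-- Cyclotomic polynomials, characterised by their standard recursive
-- definition: x^m - 1 = ∏_{d ∣ m} Φ_d(x) for every m ≥ 1
-- (this determines Φ_m uniquely for all m ≥ 1, by induction on m).
IsCyclotomic : (ℕ → Series) → Set
IsCyclotomic Φ = ∀ m → 1 ℕ.≤ m → prodₛ (map Φ (divisors m)) ≈ₛ xpow-1 m

-- Subsets of {1,…,k} as characteristic vectors, and all of them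

allSubsets : (k : ℕ) → List (Vec Bool k)
allSubsets zero    = [] ∷ []
allSubsets (suc k) = map (false ∷_) (allSubsets k) ++ map (true ∷_) (allSubsets k)

prodOn : ∀ {k} → Vec ℕ k → Vec Bool k → ℕ
prodOn []       []           = 1
prodOn (p ∷ ps) (true  ∷ I)  = p ℕ.* prodOn ps I
prodOn (p ∷ ps) (false ∷ I)  = prodOn ps I

card : ∀ {k} → Vec Bool k → ℕ
card []          = 0
card (true ∷ I)  = suc (card I)
card (false ∷ I) = card I

even : ℕ → Bool
even zero          = true
even (suc zero)    = false
even (suc (suc n)) = even n

posSubsets negSubsets : (k : ℕ) → List (Vec Bool k)
posSubsets k = filter (λ I → Data.Bool._≟_ (even (k ℕ.∸ card I)) true) (allSubsets k)
  where import Data.Bool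
negSubsets k = filter (λ I → Data.Bool._≟_ (even (k ℕ.∸ card I)) false) (allSubsets k)
  where import Data.Bool

-- Numerator and denominator of the pseudocyclotomic polynomial
-- Φ̃_{p_1..p_k} = ∏_I (x^{∏_{i∈I} p_i} - 1)^{(-1)^{k-|I|}}
pseudoNum pseudoDen : ∀ {k} → Vec ℕ k → Series
pseudoNum {k} p = prodₛ (map (λ I → xpow-1 (prodOn p I)) (posSubsets k))
pseudoDen {k} p = prodₛ (map (λ I → xpow-1 (prodOn p I)) (negSubsets k))

divisorTuples : ∀ {k} → Vec ℕ k → List (Vec ℕ k)
divisorTuples []       = [] ∷ []
divisorTuples (p ∷ ps) = cartesianProductWith _∷_ (divisors>1 p) (divisorTuples ps)

cycloProduct : (ℕ → Series) → ∀ {k} → Vec ℕ k → Series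
cycloProduct Φ p = prodₛ (map (λ m → Φ (Vec.foldr _ ℕ._*_ 1 m)) (divisorTuples p))

-- Write D(m) for the multiset of divisors of m, so that x^m − 1 = ∏_{d ∈ D(m)} Φ_d.  Both sides are
-- then products of cyclotomic polynomials, and it suffices to compare the multisets of indices
--   Σ_{k − |I| even} D(p_I)  =  T(p) + Σ_{k − |I| odd} D(p_I),
-- where p_I = ∏_{i ∈ I} p_i and T(p) is the multiset of products m_1 ⋯ m_k with 1 < m_i ∣ p_i.
-- This goes by induction on k: for q coprime to m, D(q m) = D(m) + (D(q) − {1}) · D(m); prepending q
-- to p swaps the parity of the subsets avoiding it; and T(q, p) = (D(q) − {1}) · T(p).
module Submission where

open import Defs
open import Algebra.Structures using (IsCommutativeMonoid)
open import Algebra.Structures.Biased using (isCommutativeMonoidˡ)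
open import Data.Bool as Bool using (Bool; true; false; not)
open import Data.Bool.Properties using (not-involutive)
open import Data.Fin as Fin using (Fin)
import Data.Fin.Properties as Fin
open import Data.Integer as ℤ using (ℤ; +_)
import Data.Integer.Properties as ℤ
open import Data.Integer.Tactic.RingSolver using (solve-∀)
open import Data.List as List
  using (List; []; _∷_; _++_; map; foldr; filter; upTo; concatMap; cartesianProductWith; cartesianProduct)
open import Data.List.Properties
  using ( map-++; map-∘; map-cong; map-id; map-applyUpTo; concatMap-++
        ; filter-++; filter-≐; filter-accept; filter-reject; filter-all
        ; cartesianProductWith-zeroʳ; cartesianProductWith-distribʳ-++ )
open import Data.List.Membership.Propositional using (_∈_)
open import Data.List.Membership.Propositional.Properties
  using ( ∈-filter⁺; ∈-filter⁻; ∈-upTo⁺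
        ; ∈-cartesianProductWith⁺; ∈-cartesianProductWith⁻; ∈-cartesianProduct⁻ )
open import Data.List.Membership.Propositional.Properties.WithK using (unique∧set⇒bag)
open import Data.List.Relation.Binary.BagAndSetEquality using (∼bag⇒↭)
open import Data.List.Relation.Binary.Permutation.Propositional as ↭
  using (_↭_; ↭-refl; ↭-sym; ↭-trans; ↭-reflexive; ↭⇒↭ₛ′; module PermutationReasoning)
open import Data.List.Relation.Binary.Permutation.Propositional.Properties using (++⁺ˡ; ++⁺; shifts; map⁺)
import Data.List.Relation.Binary.Permutation.Setoid.Properties as SetoidPermutation
open import Data.List.Relation.Unary.All as All using (All; []; _∷_)
import Data.List.Relation.Unary.All.Properties as All
open import Data.List.Relation.Unary.AllPairs using ([]; _∷_)
open import Data.List.Relation.Unary.Any using (here; there)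
open import Data.List.Relation.Unary.Unique.Propositional using (Unique)
import Data.List.Relation.Unary.Unique.Propositional.Properties as Unique
open import Data.Nat as ℕ using (ℕ; zero; suc; _*_; _∸_; _≤_; _<_; z≤n; s≤s; NonZero; >-nonZero)
open import Data.Nat.Properties
  using (1+n≢0; <-irrefl; *-cancelʳ-≡; *-identityˡ; *-assoc; *-mono-≤; m*n≢0; m≤n⇒m≤1+n; +-∸-assoc)
open import Data.Nat.Divisibility
  using (_∣_; _∣?_; ∣⇒≤; 0∣⇒≡0; 1∣_; ∣-trans; ∣-antisym; n∣m*n; *-pres-∣; *-cancelˡ-∣)
open import Data.Nat.DivMod using (_/_; m*[n/m]≡n)
open import Data.Nat.GCD using (gcd; gcd[m,n]∣m; gcd[m,n]∣n; gcd[m,n]≢0)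
open import Data.Nat.Coprimality as Coprime using (Coprime; coprime-divisor; coprime-/gcd; 1-coprimeTo)
open import Data.Product using (_×_; _,_; proj₂; ∃₂; uncurry)
open import Data.Sum using (inj₂)
open import Data.Vec as Vec using (Vec; []; _∷_; lookup)
open import Function using (flip; _∘_; mk⇔)
open import Relation.Binary.Bundles using (Setoid)
open import Relation.Binary.Structures using (IsEquivalence)
open import Relation.Binary.PropositionalEquality
open import Relation.Nullary using (contradiction; does)
open import Relation.Unary using (Decidable)
import Relation.Binary.Reasoning.Setoid

private variable A B C D : Set

infixl 6 _+ₛ_
infixl 7 _·ₛ_

tailₛ : Series → Series
tailₛ f n = f (suc n)

_+ₛ_ : Series → Series → Series
(f +ₛ g) n = f n ℤ.+ g n

_·ₛ_ : ℤ → Series → Series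
(a ·ₛ f) n = a ℤ.* f n

zeroₛ : Series
zeroₛ _ = + 0

≈ₛ-isEquivalence : IsEquivalence _≈ₛ_
≈ₛ-isEquivalence = record
  { refl  = λ _ → refl
  ; sym   = λ f≈g n → sym (f≈g n)
  ; trans = λ f≈g g≈h n → trans (f≈g n) (g≈h n)
  }

≈ₛ-setoid : Setoid _ _
≈ₛ-setoid = record { isEquivalence = ≈ₛ-isEquivalence }

open Setoid ≈ₛ-setoid using ()
  renaming (refl to ≈ₛ-refl; reflexive to ≈ₛ-reflexive; sym to ≈ₛ-sym; trans to ≈ₛ-trans)

*ₛ-head : ∀ f g → (f *ₛ g) 0 ≡ f 0 ℤ.* g 0
*ₛ-head f g = ℤ.+-identityʳ _

tailₛ-*ₛ : ∀ f g → tailₛ (f *ₛ g) ≈ₛ f 0 ·ₛ tailₛ g +ₛ tailₛ f *ₛ g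
tailₛ-*ₛ f g n = cong (λ xs → f 0 ℤ.* g (suc n) ℤ.+ foldr ℤ._+_ (+ 0) xs)
  (trans (map-applyUpTo suc (λ i → f i ℤ.* g (suc n ∸ i)) (suc n))
         (sym (map-applyUpTo (λ i → i) (λ i → f (suc i) ℤ.* g (n ∸ i)) (suc n))))

*ₛ-cong : ∀ {f f′ g g′} → f ≈ₛ f′ → g ≈ₛ g′ → f *ₛ g ≈ₛ f′ *ₛ g′
*ₛ-cong {f} {f′} {g} {g′} f≈f′ g≈g′ zero = begin
  (f *ₛ g) 0      ≡⟨ *ₛ-head f g ⟩
  f 0 ℤ.* g 0     ≡⟨ cong₂ ℤ._*_ (f≈f′ 0) (g≈g′ 0) ⟩
  f′ 0 ℤ.* g′ 0   ≡⟨ *ₛ-head f′ g′ ⟨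
  (f′ *ₛ g′) 0    ∎
  where open ≡-Reasoning
*ₛ-cong {f} {f′} {g} {g′} f≈f′ g≈g′ (suc n) = begin
  (f *ₛ g) (suc n)
    ≡⟨ tailₛ-*ₛ f g n ⟩
  f 0 ℤ.* g (suc n) ℤ.+ (tailₛ f *ₛ g) n
    ≡⟨ cong₂ ℤ._+_ (cong₂ ℤ._*_ (f≈f′ 0) (g≈g′ (suc n))) (*ₛ-cong (f≈f′ ∘ suc) g≈g′ n) ⟩
  f′ 0 ℤ.* g′ (suc n) ℤ.+ (tailₛ f′ *ₛ g′) n
    ≡⟨ tailₛ-*ₛ f′ g′ n ⟨
  (f′ *ₛ g′) (suc n) ∎
  where open ≡-Reasoning

*ₛ-zeroˡ : ∀ f → zeroₛ *ₛ f ≈ₛ zeroₛ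
*ₛ-zeroˡ f zero    = *ₛ-head zeroₛ f
*ₛ-zeroˡ f (suc n) =
  trans (tailₛ-*ₛ zeroₛ f n) (cong₂ ℤ._+_ (ℤ.*-zeroˡ (f (suc n))) (*ₛ-zeroˡ f n))

*ₛ-identityˡ : ∀ f → oneₛ *ₛ f ≈ₛ f
*ₛ-identityˡ f zero    = trans (*ₛ-head oneₛ f) (ℤ.*-identityˡ (f 0))
*ₛ-identityˡ f (suc n) = begin
  (oneₛ *ₛ f) (suc n)                    ≡⟨ tailₛ-*ₛ oneₛ f n ⟩
  + 1 ℤ.* f (suc n) ℤ.+ (zeroₛ *ₛ f) n   ≡⟨ cong₂ ℤ._+_ (ℤ.*-identityˡ (f (suc n))) (*ₛ-zeroˡ f n) ⟩
  f (suc n) ℤ.+ + 0                      ≡⟨ ℤ.+-identityʳ (f (suc n)) ⟩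
  f (suc n)                              ∎
  where open ≡-Reasoning

-- Unfolding the Cauchy product twice makes both sides symmetric in f and g.
*ₛ-comm : ∀ f g → f *ₛ g ≈ₛ g *ₛ f
*ₛ-comm f g zero = begin
  (f *ₛ g) 0    ≡⟨ *ₛ-head f g ⟩
  f 0 ℤ.* g 0   ≡⟨ ℤ.*-comm (f 0) (g 0) ⟩
  g 0 ℤ.* f 0   ≡⟨ *ₛ-head g f ⟨
  (g *ₛ f) 0    ∎
  where open ≡-Reasoning
*ₛ-comm f g (suc zero) = begin
  (f *ₛ g) 1                             ≡⟨ tailₛ-*ₛ f g 0 ⟩
  f 0 ℤ.* g 1 ℤ.+ (tailₛ f *ₛ g) 0       ≡⟨ cong (ℤ._+_ (f 0 ℤ.* g 1)) (*ₛ-head (tailₛ f) g) ⟩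
  f 0 ℤ.* g 1 ℤ.+ f 1 ℤ.* g 0            ≡⟨ rearrange (f 0) (g 1) (f 1) (g 0) ⟩
  g 0 ℤ.* f 1 ℤ.+ g 1 ℤ.* f 0            ≡⟨ cong (ℤ._+_ (g 0 ℤ.* f 1)) (*ₛ-head (tailₛ g) f) ⟨
  g 0 ℤ.* f 1 ℤ.+ (tailₛ g *ₛ f) 0       ≡⟨ tailₛ-*ₛ g f 0 ⟨
  (g *ₛ f) 1                             ∎
  where
  open ≡-Reasoning
  rearrange : ∀ a b c d → a ℤ.* b ℤ.+ c ℤ.* d ≡ d ℤ.* c ℤ.+ b ℤ.* a
  rearrange = solve-∀
*ₛ-comm f g (suc (suc n)) = begin
  (f *ₛ g) (suc (suc n))
    ≡⟨ tailₛ-*ₛ f g (suc n) ⟩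
  a ℤ.+ (tailₛ f *ₛ g) (suc n)
    ≡⟨ cong (ℤ._+_ a) (trans (*ₛ-comm (tailₛ f) g (suc n)) (tailₛ-*ₛ g (tailₛ f) n)) ⟩
  a ℤ.+ (b ℤ.+ (tailₛ g *ₛ tailₛ f) n)
    ≡⟨ cong (λ x → a ℤ.+ (b ℤ.+ x)) (*ₛ-comm (tailₛ g) (tailₛ f) n) ⟩
  a ℤ.+ (b ℤ.+ (tailₛ f *ₛ tailₛ g) n)
    ≡⟨ exchange a b _ ⟩
  b ℤ.+ (a ℤ.+ (tailₛ f *ₛ tailₛ g) n)
    ≡⟨ cong (ℤ._+_ b) (trans (*ₛ-comm (tailₛ g) f (suc n)) (tailₛ-*ₛ f (tailₛ g) n)) ⟨
  b ℤ.+ (tailₛ g *ₛ f) (suc n)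
    ≡⟨ tailₛ-*ₛ g f (suc n) ⟨
  (g *ₛ f) (suc (suc n)) ∎
  where
  open ≡-Reasoning
  a = f 0 ℤ.* g (suc (suc n))
  b = g 0 ℤ.* f (suc (suc n))
  exchange : ∀ a b c → a ℤ.+ (b ℤ.+ c) ≡ b ℤ.+ (a ℤ.+ c)
  exchange = solve-∀

*ₛ-linearˡ : ∀ a f g h → (a ·ₛ f +ₛ g) *ₛ h ≈ₛ a ·ₛ (f *ₛ h) +ₛ g *ₛ h
*ₛ-linearˡ a f g h zero = begin
  ((a ·ₛ f +ₛ g) *ₛ h) 0                 ≡⟨ *ₛ-head (a ·ₛ f +ₛ g) h ⟩
  (a ℤ.* f 0 ℤ.+ g 0) ℤ.* h 0            ≡⟨ expand a (f 0) (g 0) (h 0) ⟩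
  a ℤ.* (f 0 ℤ.* h 0) ℤ.+ g 0 ℤ.* h 0    ≡⟨ cong₂ (λ x y → a ℤ.* x ℤ.+ y) (*ₛ-head f h) (*ₛ-head g h) ⟨
  (a ·ₛ (f *ₛ h) +ₛ g *ₛ h) 0            ∎
  where
  open ≡-Reasoning
  expand : ∀ a x y z → (a ℤ.* x ℤ.+ y) ℤ.* z ≡ a ℤ.* (x ℤ.* z) ℤ.+ y ℤ.* z
  expand = solve-∀
*ₛ-linearˡ a f g h (suc n) = begin
  ((a ·ₛ f +ₛ g) *ₛ h) (suc n)
    ≡⟨ tailₛ-*ₛ (a ·ₛ f +ₛ g) h n ⟩
  (a ℤ.* f 0 ℤ.+ g 0) ℤ.* h (suc n) ℤ.+ ((a ·ₛ tailₛ f +ₛ tailₛ g) *ₛ h) n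
    ≡⟨ cong (ℤ._+_ ((a ℤ.* f 0 ℤ.+ g 0) ℤ.* h (suc n))) (*ₛ-linearˡ a (tailₛ f) (tailₛ g) h n) ⟩
  (a ℤ.* f 0 ℤ.+ g 0) ℤ.* h (suc n) ℤ.+ (a ℤ.* (tailₛ f *ₛ h) n ℤ.+ (tailₛ g *ₛ h) n)
    ≡⟨ expand a (f 0) (g 0) (h (suc n)) _ _ ⟩
  a ℤ.* (f 0 ℤ.* h (suc n) ℤ.+ (tailₛ f *ₛ h) n) ℤ.+ (g 0 ℤ.* h (suc n) ℤ.+ (tailₛ g *ₛ h) n)
    ≡⟨ cong₂ (λ x y → a ℤ.* x ℤ.+ y) (tailₛ-*ₛ f h n) (tailₛ-*ₛ g h n) ⟨
  (a ·ₛ (f *ₛ h) +ₛ g *ₛ h) (suc n) ∎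
  where
  open ≡-Reasoning
  expand : ∀ a x y z u v →
    (a ℤ.* x ℤ.+ y) ℤ.* z ℤ.+ (a ℤ.* u ℤ.+ v) ≡ a ℤ.* (x ℤ.* z ℤ.+ u) ℤ.+ (y ℤ.* z ℤ.+ v)
  expand = solve-∀

*ₛ-assoc : ∀ f g h → (f *ₛ g) *ₛ h ≈ₛ f *ₛ (g *ₛ h)
*ₛ-assoc f g h zero = begin
  ((f *ₛ g) *ₛ h) 0          ≡⟨ trans (*ₛ-head (f *ₛ g) h) (cong (ℤ._* h 0) (*ₛ-head f g)) ⟩
  f 0 ℤ.* g 0 ℤ.* h 0        ≡⟨ ℤ.*-assoc (f 0) (g 0) (h 0) ⟩
  f 0 ℤ.* (g 0 ℤ.* h 0)      ≡⟨ trans (*ₛ-head f (g *ₛ h)) (cong (f 0 ℤ.*_) (*ₛ-head g h)) ⟨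
  (f *ₛ (g *ₛ h)) 0          ∎
  where open ≡-Reasoning
*ₛ-assoc f g h (suc n) = begin
  ((f *ₛ g) *ₛ h) (suc n)
    ≡⟨ tailₛ-*ₛ (f *ₛ g) h n ⟩
  (f *ₛ g) 0 ℤ.* h (suc n) ℤ.+ (tailₛ (f *ₛ g) *ₛ h) n
    ≡⟨ cong₂ ℤ._+_ (cong (ℤ._* h (suc n)) (*ₛ-head f g))
                   (*ₛ-cong (tailₛ-*ₛ f g) (≈ₛ-refl {h}) n) ⟩
  f 0 ℤ.* g 0 ℤ.* h (suc n) ℤ.+ ((f 0 ·ₛ tailₛ g +ₛ tailₛ f *ₛ g) *ₛ h) n
    ≡⟨ cong (ℤ._+_ (f 0 ℤ.* g 0 ℤ.* h (suc n)))
            (trans (*ₛ-linearˡ (f 0) (tailₛ g) (tailₛ f *ₛ g) h n)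
                   (cong (ℤ._+_ (f 0 ℤ.* (tailₛ g *ₛ h) n)) (*ₛ-assoc (tailₛ f) g h n))) ⟩
  f 0 ℤ.* g 0 ℤ.* h (suc n) ℤ.+ (f 0 ℤ.* (tailₛ g *ₛ h) n ℤ.+ (tailₛ f *ₛ (g *ₛ h)) n)
    ≡⟨ regroup (f 0) (g 0) (h (suc n)) _ _ ⟩
  f 0 ℤ.* (g 0 ℤ.* h (suc n) ℤ.+ (tailₛ g *ₛ h) n) ℤ.+ (tailₛ f *ₛ (g *ₛ h)) n
    ≡⟨ cong (λ x → f 0 ℤ.* x ℤ.+ (tailₛ f *ₛ (g *ₛ h)) n) (tailₛ-*ₛ g h n) ⟨
  f 0 ℤ.* (g *ₛ h) (suc n) ℤ.+ (tailₛ f *ₛ (g *ₛ h)) n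
    ≡⟨ tailₛ-*ₛ f (g *ₛ h) n ⟨
  (f *ₛ (g *ₛ h)) (suc n) ∎
  where
  open ≡-Reasoning
  regroup : ∀ a b c x y → a ℤ.* b ℤ.* c ℤ.+ (a ℤ.* x ℤ.+ y) ≡ a ℤ.* (b ℤ.* c ℤ.+ x) ℤ.+ y
  regroup = solve-∀

*ₛ-isCommutativeMonoid : IsCommutativeMonoid _≈ₛ_ _*ₛ_ oneₛ
*ₛ-isCommutativeMonoid = isCommutativeMonoidˡ record
  { isSemigroup = record
    { isMagma = record { isEquivalence = ≈ₛ-isEquivalence ; ∙-cong = *ₛ-cong }
    ; assoc   = *ₛ-assoc
    }
  ; identityˡ = *ₛ-identityˡ
  ; comm      = *ₛ-comm
  }

prodₛ-++ : ∀ fs gs → prodₛ (fs ++ gs) ≈ₛ prodₛ fs *ₛ prodₛ gs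
prodₛ-++ []       gs = ≈ₛ-sym (*ₛ-identityˡ (prodₛ gs))
prodₛ-++ (f ∷ fs) gs =
  ≈ₛ-trans (*ₛ-cong (≈ₛ-refl {f}) (prodₛ-++ fs gs)) (≈ₛ-sym (*ₛ-assoc f (prodₛ fs) (prodₛ gs)))

prodₛ-↭ : ∀ {fs gs} → fs ↭ gs → prodₛ fs ≈ₛ prodₛ gs
prodₛ-↭ fs↭gs = SetoidPermutation.foldr-commMonoid ≈ₛ-setoid *ₛ-isCommutativeMonoid
  (↭⇒↭ₛ′ ≈ₛ-isEquivalence fs↭gs)

Unique-map⁺-on : ∀ {f : A → B} {xs} → (∀ {x y} → x ∈ xs → y ∈ xs → f x ≡ f y → x ≡ y) →
                 Unique xs → Unique (map f xs)
Unique-map⁺-on inj []            = []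
Unique-map⁺-on inj (x∉xs ∷ uxs) =
  All.map⁺ (All.tabulate λ y∈xs fx≡fy → All.lookup x∉xs y∈xs (inj (here refl) (there y∈xs) fx≡fy))
  ∷ Unique-map⁺-on (λ x∈ y∈ → inj (there x∈) (there y∈)) uxs

map-uncurry-cartesianProduct : ∀ (f : A → B → C) xs ys →
  map (uncurry f) (cartesianProduct xs ys) ≡ cartesianProductWith f xs ys
map-uncurry-cartesianProduct f []       ys = refl
map-uncurry-cartesianProduct f (x ∷ xs) ys = begin
  map (uncurry f) (map (x ,_) ys ++ cartesianProduct xs ys)
    ≡⟨ map-++ _ (map (x ,_) ys) _ ⟩
  map (uncurry f) (map (x ,_) ys) ++ map (uncurry f) (cartesianProduct xs ys)
    ≡⟨ cong₂ _++_ (sym (map-∘ ys)) (map-uncurry-cartesianProduct f xs ys) ⟩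
  map (f x) ys ++ cartesianProductWith f xs ys      ∎
  where open ≡-Reasoning

Unique-cartesianProductWith⁺-on : ∀ (f : A → B → C) {xs ys} →
  (∀ {w x y z} → w ∈ xs → x ∈ xs → y ∈ ys → z ∈ ys → f w y ≡ f x z → w ≡ x × y ≡ z) →
  Unique xs → Unique ys → Unique (cartesianProductWith f xs ys)
Unique-cartesianProductWith⁺-on f {xs} {ys} inj uxs uys =
  subst Unique (map-uncurry-cartesianProduct f xs ys)
    (Unique-map⁺-on injOnPairs (Unique.cartesianProduct⁺ uxs uys))
  where
  injOnPairs : ∀ {p p′} → p ∈ cartesianProduct xs ys → p′ ∈ cartesianProduct xs ys →
               uncurry f p ≡ uncurry f p′ → p ≡ p′
  injOnPairs p∈ p′∈ e with ∈-cartesianProduct⁻ xs ys p∈ | ∈-cartesianProduct⁻ xs ys p′∈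
  ... | w∈ , y∈ | x∈ , z∈ = uncurry (cong₂ _,_) (inj w∈ x∈ y∈ z∈ e)

filter-map : ∀ {P : B → Set} (P? : Decidable P) (f : A → B) xs →
             filter P? (map f xs) ≡ map f (filter (P? ∘ f) xs)
filter-map P? f [] = refl
filter-map P? f (x ∷ xs) with does (P? (f x))
... | true  = cong (f x ∷_) (filter-map P? f xs)
... | false = filter-map P? f xs

cartesianProductWith-∷ʳ : ∀ (f : A → B → C) xs y ys →
  cartesianProductWith f xs (y ∷ ys) ↭ map (flip f y) xs ++ cartesianProductWith f xs ys
cartesianProductWith-∷ʳ f []       y ys = ↭-refl
cartesianProductWith-∷ʳ f (x ∷ xs) y ys = ↭.prep (f x y)
  (↭-trans (++⁺ˡ (map (f x) ys) (cartesianProductWith-∷ʳ f xs y ys))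
           (shifts (map (f x) ys) (map (flip f y) xs)))

cartesianProductWith-flip : ∀ (f : A → B → C) xs ys →
  cartesianProductWith f xs ys ↭ cartesianProductWith (flip f) ys xs
cartesianProductWith-flip f []       ys = ↭-reflexive (sym (cartesianProductWith-zeroʳ (flip f) ys))
cartesianProductWith-flip f (x ∷ xs) ys = ↭-trans (++⁺ˡ (map (f x) ys) (cartesianProductWith-flip f xs ys))
                                                  (↭-sym (cartesianProductWith-∷ʳ (flip f) ys x xs))

cartesianProductWith⁺ˡ : ∀ (f : A → B → C) {xs xs′} ys → xs ↭ xs′ →
  cartesianProductWith f xs ys ↭ cartesianProductWith f xs′ ys
cartesianProductWith⁺ˡ f ys ↭.refl          = ↭-refl
cartesianProductWith⁺ˡ f ys (↭.prep x p)   = ++⁺ˡ (map (f x) ys) (cartesianProductWith⁺ˡ f ys p)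
cartesianProductWith⁺ˡ f ys (↭.swap x y p) = ↭-trans (shifts (map (f x) ys) (map (f y) ys))
  (++⁺ˡ (map (f y) ys) (++⁺ˡ (map (f x) ys) (cartesianProductWith⁺ˡ f ys p)))
cartesianProductWith⁺ˡ f ys (↭.trans p q)  =
  ↭-trans (cartesianProductWith⁺ˡ f ys p) (cartesianProductWith⁺ˡ f ys q)

map-cartesianProductWith : ∀ (g : C → D) (f : A → B → C) xs ys →
  map g (cartesianProductWith f xs ys) ≡ cartesianProductWith (λ x y → g (f x y)) xs ys
map-cartesianProductWith g f []       ys = refl
map-cartesianProductWith g f (x ∷ xs) ys =
  trans (map-++ g (map (f x) ys) _) (cong₂ _++_ (sym (map-∘ ys)) (map-cartesianProductWith g f xs ys))

cartesianProductWith-mapʳ : ∀ (f : A → C → D) (g : B → C) xs ys →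
  cartesianProductWith f xs (map g ys) ≡ cartesianProductWith (λ x y → f x (g y)) xs ys
cartesianProductWith-mapʳ f g []       ys = refl
cartesianProductWith-mapʳ f g (x ∷ xs) ys = cong₂ _++_ (sym (map-∘ ys)) (cartesianProductWith-mapʳ f g xs ys)

∈-divisors⁺ : ∀ {d n} .{{_ : NonZero n}} → d ∣ n → d ∈ divisors n
∈-divisors⁺ d∣n = ∈-filter⁺ (_∣? _) (∈-upTo⁺ (s≤s (∣⇒≤ d∣n))) d∣n

∈-divisors⁻ : ∀ n {d} → d ∈ divisors n → d ∣ n
∈-divisors⁻ n d∈ = proj₂ (∈-filter⁻ (_∣? n) {xs = upTo (suc n)} d∈)

divisors-unique : ∀ n → Unique (divisors n)
divisors-unique n = Unique.filter⁺ (_∣? n) (Unique.upTo⁺ (suc n))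

divisors≡1∷divisors>1 : ∀ n .{{_ : NonZero n}} → divisors n ≡ 1 ∷ divisors>1 n
divisors≡1∷divisors>1 (suc n) = trans divisors≡1∷ds (cong (1 ∷_) (sym divisors>1≡ds))
  where
  ds = filter (_∣? suc n) (List.applyUpTo (λ i → suc (suc i)) n)
  divisors≡1∷ds : divisors (suc n) ≡ 1 ∷ ds
  divisors≡1∷ds = trans
    (filter-reject (_∣? suc n) {x = 0} {xs = 1 ∷ List.applyUpTo (λ i → suc (suc i)) n} (1+n≢0 ∘ 0∣⇒≡0))
    (filter-accept (_∣? suc n) {x = 1} (1∣ _))
  ds>1 : All (1 <_) ds
  ds>1 = All.filter⁺ (_∣? suc n) (All.applyUpTo⁺₂ (λ i → suc (suc i)) n (λ _ → s≤s (s≤s z≤n)))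
  divisors>1≡ds : divisors>1 (suc n) ≡ ds
  divisors>1≡ds = trans (cong (filter (1 ℕ.<?_)) divisors≡1∷ds)
    (trans (filter-reject (1 ℕ.<?_) {x = 1} {xs = ds} (<-irrefl refl)) (filter-all (1 ℕ.<?_) ds>1))

∣⇒nonZero : ∀ {m n} .{{_ : NonZero n}} → m ∣ n → NonZero m
∣⇒nonZero {zero}  {n} 0∣n = contradiction (0∣⇒≡0 0∣n) (ℕ.≢-nonZero⁻¹ n)
∣⇒nonZero {suc m}     _   = _

-- Take a = gcd z m: then z / a and m / a are coprime, and z / a divides (m / a) * n.
∣m*n⇒∃factors : ∀ {z} m {n} .{{_ : NonZero m}} → z ∣ m * n →
                ∃₂ λ a b → a ∣ m × b ∣ n × z ≡ a * b
∣m*n⇒∃factors {z} m {n} z∣mn = g , z / g , gcd[m,n]∣n z m , z/g∣n , sym (m*[n/m]≡n (gcd[m,n]∣m z m))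
  where
  g = gcd z m
  instance
    g≢0 : NonZero g
    g≢0 = ℕ.≢-nonZero (gcd[m,n]≢0 z m (inj₂ (ℕ.≢-nonZero⁻¹ m)))
  z/g∣n : z / g ∣ n
  z/g∣n = coprime-divisor (coprime-/gcd z m) (*-cancelˡ-∣ g (subst₂ _∣_
    (sym (m*[n/m]≡n (gcd[m,n]∣m z m)))
    (trans (cong (_* n) (sym (m*[n/m]≡n (gcd[m,n]∣n z m)))) (*-assoc g (m / g) n))
    z∣mn))

divisors-*-injective : ∀ {m n a b c d} → Coprime m n → a ∣ m → c ∣ m → b ∣ n → d ∣ n →
                       .{{_ : NonZero n}} → a * b ≡ c * d → a ≡ c × b ≡ d
divisors-*-injective {m} {n} {a} {b} {c} {d} m⊥n a∣m c∣m b∣n d∣n ab≡cd =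
  *-cancelʳ-≡ a c b {{∣⇒nonZero b∣n}} (trans ab≡cd (cong (c *_) (sym b≡d))) , b≡d
  where
  coprimeWith : ∀ {e f} → e ∣ n → f ∣ m → Coprime e f
  coprimeWith e∣n f∣m (i∣e , i∣f) = Coprime.sym m⊥n (∣-trans i∣e e∣n , ∣-trans i∣f f∣m)
  b≡d : b ≡ d
  b≡d = ∣-antisym (coprime-divisor (coprimeWith b∣n c∣m) (subst (b ∣_) ab≡cd (n∣m*n a)))
                  (coprime-divisor (coprimeWith d∣n a∣m) (subst (d ∣_) (sym ab≡cd) (n∣m*n c)))

divisors-*-↭ : ∀ m n .{{m≢0 : NonZero m}} .{{n≢0 : NonZero n}} → Coprime m n →
               divisors (m * n) ↭ cartesianProductWith (flip _*_) (divisors n) (divisors m)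
divisors-*-↭ m n m⊥n = ∼bag⇒↭ (unique∧set⇒bag (divisors-unique (m * n)) unique (mk⇔ to from))
  where
  instance
    mn≢0 : NonZero (m * n)
    mn≢0 = m*n≢0 m n
  unique : Unique (cartesianProductWith (flip _*_) (divisors n) (divisors m))
  unique = Unique-cartesianProductWith⁺-on (flip _*_)
    (λ w∈ x∈ y∈ z∈ yw≡zx →
      let y≡z , w≡x = divisors-*-injective m⊥n (∈-divisors⁻ m y∈) (∈-divisors⁻ m z∈)
                        (∈-divisors⁻ n w∈) (∈-divisors⁻ n x∈) yw≡zx
      in w≡x , y≡z)
    (divisors-unique n) (divisors-unique m)
  to : ∀ {z} → z ∈ divisors (m * n) → z ∈ cartesianProductWith (flip _*_) (divisors n) (divisors m)
  to z∈ with ∣m*n⇒∃factors m (∈-divisors⁻ (m * n) z∈)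
  ... | a , b , a∣m , b∣n , refl =
    ∈-cartesianProductWith⁺ (flip _*_) (∈-divisors⁺ b∣n) (∈-divisors⁺ a∣m)
  from : ∀ {z} → z ∈ cartesianProductWith (flip _*_) (divisors n) (divisors m) → z ∈ divisors (m * n)
  from z∈ with ∈-cartesianProductWith⁻ (flip _*_) (divisors n) (divisors m) z∈
  ... | b , a , b∈ , a∈ , refl = ∈-divisors⁺ (*-pres-∣ (∈-divisors⁻ m a∈) (∈-divisors⁻ n b∈))

subsetsWithParity : (k : ℕ) → Bool → List (Vec Bool k)
subsetsWithParity k b = filter (λ I → even (k ∸ card I) Bool.≟ b) (allSubsets k)

card≤ : ∀ {k} (I : Vec Bool k) → card I ≤ k
card≤ []          = z≤n
card≤ (true ∷ I)  = s≤s (card≤ I)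
card≤ (false ∷ I) = m≤n⇒m≤1+n (card≤ I)

even-suc : ∀ n → even (suc n) ≡ not (even n)
even-suc zero          = refl
even-suc (suc zero)    = refl
even-suc (suc (suc n)) = even-suc n

subsetsWithParity-suc : ∀ k b → subsetsWithParity (suc k) b ≡
  map (false ∷_) (subsetsWithParity k (not b)) ++ map (true ∷_) (subsetsWithParity k b)
subsetsWithParity-suc k b = begin
  filter P? (map (false ∷_) (allSubsets k) ++ map (true ∷_) (allSubsets k))
    ≡⟨ filter-++ P? (map (false ∷_) (allSubsets k)) _ ⟩
  filter P? (map (false ∷_) (allSubsets k)) ++ filter P? (map (true ∷_) (allSubsets k))
    ≡⟨ cong₂ _++_ (trans (filter-map P? (false ∷_) (allSubsets k))
                         (cong (map (false ∷_))
                           (filter-≐ _ _ ((λ {I} → flipped {I}) , (λ {I} → unflipped {I})) (allSubsets k))))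
                  (filter-map P? (true ∷_) (allSubsets k)) ⟩
  map (false ∷_) (subsetsWithParity k (not b)) ++ map (true ∷_) (subsetsWithParity k b) ∎
  where
  open ≡-Reasoning
  P? = λ (I : Vec Bool (suc k)) → even (suc k ∸ card I) Bool.≟ b
  even-suc-∸ : ∀ I → even (suc k ∸ card I) ≡ not (even (k ∸ card I))
  even-suc-∸ I = trans (cong even (+-∸-assoc 1 (card≤ I))) (even-suc (k ∸ card I))
  flipped : ∀ {I} → even (suc k ∸ card I) ≡ b → even (k ∸ card I) ≡ not b
  flipped {I} e = trans (sym (not-involutive _)) (cong not (trans (sym (even-suc-∸ I)) e))
  unflipped : ∀ {I} → even (k ∸ card I) ≡ not b → even (suc k ∸ card I) ≡ b
  unflipped {I} e = trans (even-suc-∸ I) (trans (cong not e) (not-involutive b))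

prodOn-closed : ∀ (P : ℕ → Set) → P 1 → (∀ {m n} → P m → P n → P (m * n)) →
                ∀ {k} (p : Vec ℕ k) → (∀ i → P (lookup p i)) → ∀ I → P (prodOn p I)
prodOn-closed P P1 P* []      Pp []          = P1
prodOn-closed P P1 P* (q ∷ p) Pp (true ∷ I)  = P* (Pp Fin.zero) (prodOn-closed P P1 P* p (Pp ∘ Fin.suc) I)
prodOn-closed P P1 P* (q ∷ p) Pp (false ∷ I) = prodOn-closed P P1 P* p (Pp ∘ Fin.suc) I

coprime-*ʳ : ∀ {l m n} → Coprime l m → Coprime l n → Coprime l (m * n)
coprime-*ʳ l⊥m l⊥n (i∣l , i∣mn) =
  l⊥n (i∣l , coprime-divisor (λ (j∣i , j∣m) → l⊥m (∣-trans j∣i i∣l , j∣m)) i∣mn)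

multiplesByDivisors>1 : ℕ → List ℕ → List ℕ
multiplesByDivisors>1 q xs = cartesianProductWith (flip _*_) xs (divisors>1 q)

concatMap-divisors-*ˡ : ∀ q .{{_ : NonZero q}} ms → All (λ m → NonZero m × Coprime q m) ms →
  concatMap divisors (map (q *_) ms) ↭ concatMap divisors ms ++ multiplesByDivisors>1 q (concatMap divisors ms)
concatMap-divisors-*ˡ q ms ms-ok = begin
  concatMap divisors (map (q *_) ms)
    ↭⟨ factorwise ms ms-ok ⟩
  cartesianProductWith (flip _*_) (concatMap divisors ms) (divisors q)
    ≡⟨ cong (cartesianProductWith (flip _*_) (concatMap divisors ms)) (divisors≡1∷divisors>1 q) ⟩
  cartesianProductWith (flip _*_) (concatMap divisors ms) (1 ∷ divisors>1 q)
    ↭⟨ cartesianProductWith-∷ʳ (flip _*_) (concatMap divisors ms) 1 (divisors>1 q) ⟩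
  map (1 *_) (concatMap divisors ms) ++ multiplesByDivisors>1 q (concatMap divisors ms)
    ≡⟨ cong (_++ multiplesByDivisors>1 q (concatMap divisors ms))
            (trans (map-cong *-identityˡ (concatMap divisors ms)) (map-id (concatMap divisors ms))) ⟩
  concatMap divisors ms ++ multiplesByDivisors>1 q (concatMap divisors ms) ∎
  where
  open PermutationReasoning
  factorwise : ∀ ms → All (λ m → NonZero m × Coprime q m) ms →
    concatMap divisors (map (q *_) ms) ↭ cartesianProductWith (flip _*_) (concatMap divisors ms) (divisors q)
  factorwise []       []                    = ↭-refl
  factorwise (m ∷ ms) ((m≢0 , q⊥m) ∷ ms-ok) = ↭-trans
    (++⁺ (divisors-*-↭ q m {{n≢0 = m≢0}} q⊥m) (factorwise ms ms-ok))
    (↭-reflexive (sym (cartesianProductWith-distribʳ-++ (flip _*_) (divisors m) _ (divisors q))))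

divisorTupleProducts : ∀ {k} → Vec ℕ k → List ℕ
divisorTupleProducts p = map (Vec.foldr _ _*_ 1) (divisorTuples p)

divisorTupleProducts-∷ : ∀ {k} q (p : Vec ℕ k) →
  divisorTupleProducts (q ∷ p) ↭ multiplesByDivisors>1 q (divisorTupleProducts p)
divisorTupleProducts-∷ q p = begin
  map (Vec.foldr _ _*_ 1) (cartesianProductWith _∷_ (divisors>1 q) (divisorTuples p))
    ≡⟨ map-cartesianProductWith (Vec.foldr _ _*_ 1) _∷_ (divisors>1 q) (divisorTuples p) ⟩
  cartesianProductWith (λ a t → a * Vec.foldr _ _*_ 1 t) (divisors>1 q) (divisorTuples p)
    ≡⟨ cartesianProductWith-mapʳ _*_ (Vec.foldr _ _*_ 1) (divisors>1 q) (divisorTuples p) ⟨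
  cartesianProductWith _*_ (divisors>1 q) (divisorTupleProducts p)
    ↭⟨ cartesianProductWith-flip _*_ (divisors>1 q) (divisorTupleProducts p) ⟩
  multiplesByDivisors>1 q (divisorTupleProducts p) ∎
  where open PermutationReasoning

-- The multiset of d such that Φ_d is a factor of the numerator (b = true) or the denominator
-- (b = false) of the pseudocyclotomic polynomial.
cyclotomicIndices : ∀ {k} → Vec ℕ k → Bool → List ℕ
cyclotomicIndices {k} p b = concatMap divisors (map (prodOn p) (subsetsWithParity k b))

cyclotomicIndices-∷ : ∀ {k} q (p : Vec ℕ k) b .{{_ : NonZero q}} →
  (∀ i → NonZero (lookup p i) × Coprime q (lookup p i)) →
  cyclotomicIndices (q ∷ p) b ↭
    cyclotomicIndices p (not b) ++ (cyclotomicIndices p b ++ multiplesByDivisors>1 q (cyclotomicIndices p b))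
cyclotomicIndices-∷ {k} q p b p-ok = begin
  concatMap divisors (map (prodOn (q ∷ p)) (subsetsWithParity (suc k) b))
    ≡⟨ cong (concatMap divisors ∘ map (prodOn (q ∷ p))) (subsetsWithParity-suc k b) ⟩
  concatMap divisors (map (prodOn (q ∷ p)) (map (false ∷_) Sₙ ++ map (true ∷_) Sₚ))
    ≡⟨ cong (concatMap divisors) (trans (map-++ (prodOn (q ∷ p)) (map (false ∷_) Sₙ) _)
         (cong₂ _++_ (sym (map-∘ Sₙ)) (trans (sym (map-∘ Sₚ)) (map-∘ Sₚ)))) ⟩
  concatMap divisors (map (prodOn p) Sₙ ++ map (q *_) (map (prodOn p) Sₚ))
    ≡⟨ concatMap-++ divisors (map (prodOn p) Sₙ) _ ⟩
  cyclotomicIndices p (not b) ++ concatMap divisors (map (q *_) (map (prodOn p) Sₚ))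
    ↭⟨ ++⁺ˡ (cyclotomicIndices p (not b)) (concatMap-divisors-*ˡ q (map (prodOn p) Sₚ) Sₚ-ok) ⟩
  cyclotomicIndices p (not b) ++ (cyclotomicIndices p b ++ multiplesByDivisors>1 q (cyclotomicIndices p b)) ∎
  where
  open PermutationReasoning
  Sₙ = subsetsWithParity k (not b)
  Sₚ = subsetsWithParity k b
  Sₚ-ok : All (λ m → NonZero m × Coprime q m) (map (prodOn p) Sₚ)
  Sₚ-ok = All.map⁺ (All.universal (prodOn-closed (λ m → NonZero m × Coprime q m)
    (_ , Coprime.sym (1-coprimeTo q))
    (λ (m≢0 , q⊥m) (n≢0 , q⊥n) → m*n≢0 _ _ {{m≢0}} {{n≢0}} , coprime-*ʳ q⊥m q⊥n) p p-ok) Sₚ)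

cyclotomicIndices-true : ∀ {k} (p : Vec ℕ k) → (∀ i → NonZero (lookup p i)) →
  (∀ i j → i ≢ j → Coprime (lookup p i) (lookup p j)) →
  cyclotomicIndices p true ↭ divisorTupleProducts p ++ cyclotomicIndices p false
cyclotomicIndices-true []      p≢0 p-coprime = ↭-refl
cyclotomicIndices-true (q ∷ p) p≢0 p-coprime = begin
  cyclotomicIndices (q ∷ p) true
    ↭⟨ cyclotomicIndices-∷ q p true p-ok ⟩
  N ++ (P ++ M P)
    ↭⟨ ++⁺ˡ N (++⁺ˡ P (cartesianProductWith⁺ˡ (flip _*_) (divisors>1 q)
         (cyclotomicIndices-true p (p≢0 ∘ Fin.suc) p-coprime′))) ⟩
  N ++ (P ++ M (T ++ N))
    ≡⟨ cong (λ xs → N ++ (P ++ xs)) (cartesianProductWith-distribʳ-++ (flip _*_) T N (divisors>1 q)) ⟩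
  N ++ (P ++ (M T ++ M N))
    ↭⟨ ↭-trans (shifts N P) (↭-trans (++⁺ˡ P (shifts N (M T))) (shifts P (M T))) ⟩
  M T ++ (P ++ (N ++ M N))
    ↭⟨ ++⁺ (divisorTupleProducts-∷ q p) (cyclotomicIndices-∷ q p false p-ok) ⟨
  divisorTupleProducts (q ∷ p) ++ cyclotomicIndices (q ∷ p) false ∎
  where
  open PermutationReasoning
  instance
    q≢0 : NonZero q
    q≢0 = p≢0 Fin.zero
  P = cyclotomicIndices p true
  N = cyclotomicIndices p false
  T = divisorTupleProducts p
  M = multiplesByDivisors>1 q
  p-ok : ∀ i → NonZero (lookup p i) × Coprime q (lookup p i)
  p-ok i = p≢0 (Fin.suc i) , p-coprime Fin.zero (Fin.suc i) (λ ())
  p-coprime′ : ∀ i j → i ≢ j → Coprime (lookup p i) (lookup p j)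
  p-coprime′ i j i≢j = p-coprime (Fin.suc i) (Fin.suc j) (i≢j ∘ Fin.suc-injective)

prodₛ-map-++ : ∀ (Φ : ℕ → Series) xs ys →
               prodₛ (map Φ (xs ++ ys)) ≈ₛ prodₛ (map Φ xs) *ₛ prodₛ (map Φ ys)
prodₛ-map-++ Φ xs ys =
  ≈ₛ-trans (≈ₛ-reflexive (cong prodₛ (map-++ Φ xs ys))) (prodₛ-++ (map Φ xs) (map Φ ys))

prodₛ-xpow-1 : ∀ {Φ} → IsCyclotomic Φ → ∀ ms → All (1 ≤_) ms →
               prodₛ (map xpow-1 ms) ≈ₛ prodₛ (map Φ (concatMap divisors ms))
prodₛ-xpow-1         cyc []       []           = ≈ₛ-refl
prodₛ-xpow-1 {Φ} cyc (m ∷ ms) (1≤m ∷ ms-ok) =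
  ≈ₛ-trans (*ₛ-cong (≈ₛ-sym (cyc m 1≤m)) (prodₛ-xpow-1 cyc ms ms-ok))
           (≈ₛ-sym (prodₛ-map-++ Φ (divisors m) (concatMap divisors ms)))

proposition4p3 : (Φ : ℕ → Series) → IsCyclotomic Φ →
    (k : ℕ) (p : Vec ℕ k) →
    (∀ i → 0 < lookup p i) →
    (∀ (i j : Fin k) → i ≢ j → Coprime (lookup p i) (lookup p j)) →
    pseudoNum p ≈ₛ cycloProduct Φ p *ₛ pseudoDen p
proposition4p3 Φ cyc k p p>0 p-coprime = begin
  pseudoNum p
    ≈⟨ xpow-1-factorisation true ⟩
  prodₛ (map Φ (cyclotomicIndices p true))
    ≈⟨ prodₛ-↭ (map⁺ Φ (cyclotomicIndices-true p (>-nonZero ∘ p>0) p-coprime)) ⟩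
  prodₛ (map Φ (divisorTupleProducts p ++ cyclotomicIndices p false))
    ≈⟨ prodₛ-map-++ Φ (divisorTupleProducts p) (cyclotomicIndices p false) ⟩
  prodₛ (map Φ (divisorTupleProducts p)) *ₛ prodₛ (map Φ (cyclotomicIndices p false))
    ≈⟨ *ₛ-cong (≈ₛ-reflexive (cong prodₛ (sym (map-∘ (divisorTuples p)))))
               (≈ₛ-sym (xpow-1-factorisation false)) ⟩
  cycloProduct Φ p *ₛ pseudoDen p ∎
  where
  open Relation.Binary.Reasoning.Setoid ≈ₛ-setoid
  xpow-1-factorisation : ∀ b → prodₛ (map (λ I → xpow-1 (prodOn p I)) (subsetsWithParity k b))
                                 ≈ₛ prodₛ (map Φ (cyclotomicIndices p b))
  xpow-1-factorisation b = ≈ₛ-trans (≈ₛ-reflexive (cong prodₛ (map-∘ (subsetsWithParity k b))))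
    (prodₛ-xpow-1 cyc (map (prodOn p) (subsetsWithParity k b))
      (All.map⁺ (All.universal (prodOn-closed (1 ≤_) (s≤s z≤n) *-mono-≤ p p>0) (subsetsWithParity k b))))
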